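{- Let $N$ be a primitive non-deficient number, and write $N = p_1^{a_1} p_2^{a_2} \cdots p_k^{a_k}$ with $p_1, \dots, p_k$ distinct primes; let $R = p_1 p_2 \cdots p_k$. Suppose that $a_i \ge 2$ for all $i$ with $1 \le i \le k$. Then there exists $j$ with $1 \le j \le k$ such that $p_j^{a_j+1} < 8R^{3/2}$.
   Context: $\sigma(n)$ is the sum of the positive divisors of $n$. A positive integer $n$ is deficient if $\sigma(n) < 2n$; $n$ is primitive non-deficient if $\sigma(n) \ge 2n$ and every proper divisor of $n$ is deficient. -}

module Defs where

open import Data.Nat using (ℕ; zero; suc; _+_; _*_; _^_; _<_; _≥_)
open import Data.Nat.Divisibility using (_∣_; _∣?_)
open import Data.List using (List; filter; upTo; map)
open import Data.Nat.ListAction using (sum)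
open import Data.Product using (_×_)
open import Data.Fin using (Fin)
open import Relation.Nullary using (¬_)

-- divisors of n : the d with 1 ≤ d ≤ n and d ∣ n  (empty for n = 0)
divisors : ℕ → List ℕ
divisors n = filter (λ d → d ∣? n) (map suc (upTo n))

σ : ℕ → ℕ
σ n = sum (divisors n)

Deficient : ℕ → Set
Deficient n = (0 < n) × (σ n < 2 * n)

ProperDivisor : ℕ → ℕ → Set
ProperDivisor d n = d ∣ n × 0 < d × d < n

PrimitiveNonDeficient : ℕ → Set
PrimitiveNonDeficient n =
  (0 < n) × (σ n ≥ 2 * n) × (∀ d → ProperDivisor d n → Deficient d)

∏ : (k : ℕ) → (Fin k → ℕ) → ℕ
∏ zero f = 1
∏ (suc k) f = f Fin.zero * ∏ k (λ i → f (Fin.suc i))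

module Submission where

-- Let N = ∏ pᵢ^aᵢ be primitive non-deficient with all aᵢ ≥ 2, and put R = ∏ pᵢ,
-- Φ = ∏ (pᵢ - 1) and Xᵢ = pᵢ^(aᵢ+1).  Since σ(pᵢ^aᵢ)(pᵢ - 1) = Xᵢ - 1 and σ is
-- multiplicative, σ(N) Φ = ∏ (Xᵢ - 1) and N R = ∏ Xᵢ.  Suppose every Xⱼ² ≥ 64 R³.
--  * Abundance of N gives 2NΦ ≤ ∏ (Xᵢ - 1) < N R, so 2Φ < R.
--  * For the proper divisor N' = N / p₀ the same formulas hold with X₀ replaced by
--    p₀^a₀.  From X₀² ≤ (p₀^a₀)³ we get p₀^a₀ ≥ 2R; with Y = min Xⱼ and m² ≤ R
--    (m + 1 primes) we get Y ≥ 2mR.  A union bound then gives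
--    σ(N') Φ ≥ (1 - 1/R) N' R ≥ 2N'Φ, so N' is not deficient: a contradiction.

open import Defs
open import Data.Nat using (ℕ; _*_; _^_; _<_; _≥_; suc)
open import Data.Nat.Primality using (Prime)
open import Data.Fin using (Fin)
open import Data.Product using (Σ; ∃; _×_; _,_)
open import Data.Product using (proj₁; proj₂)
open import Function.Definitions using (Injective)
open import Relation.Binary.PropositionalEquality using (_≡_)

open import Data.Nat using (zero; pred; _+_; _∸_; _≤_; _≤?_; _<?_; z≤n; s≤s; NonZero; >-nonZero; nonTrivial⇒n>1)
open import Data.Nat.Properties
open import Data.Nat.Divisibility
open import Data.Nat.Primality using (prime; prime⇒irreducible; euclidsLemma)
open import Data.Nat.Coprimality using (Coprime; coprime-divisor)
open import Data.Nat.ListAction using (sum)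
open import Data.Nat.ListAction.Properties using (sum-++)
open import Data.Nat.Tactic.RingSolver using (solve-∀)
open import Data.Bool using (true; false; if_then_else_)
open import Data.List using (List; []; _∷_; filter; upTo; map; _++_)
open import Data.List.Properties using (upTo-∷ʳ; map-++)
open import Data.Fin using () renaming (zero to fzero; suc to fsuc)
open import Data.Fin.Properties using (any?) renaming (suc-injective to fsuc-injective; 0≢1+n to fzero≢fsuc)
open import Data.Sum using (inj₁; inj₂)
open import Data.Empty using (⊥-elim)
open import Relation.Nullary using (¬_; does; yes; no)
open import Relation.Binary.PropositionalEquality using (refl; sym; trans; cong; cong₂; subst; module ≡-Reasoning)

sumTo : ℕ → (ℕ → ℕ) → ℕ
sumTo zero    g = 0
sumTo (suc n) g = sumTo n g + g (suc n)

divisorTerm : ℕ → ℕ → ℕ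
divisorTerm n d = if does (d ∣? n) then d else 0

sum-filter-divides : ∀ n (xs : List ℕ) →
  sum (filter (_∣? n) xs) ≡ sum (map (divisorTerm n) xs)
sum-filter-divides n []       = refl
sum-filter-divides n (x ∷ xs) with does (x ∣? n)
... | true  = cong (x +_) (sum-filter-divides n xs)
... | false = sum-filter-divides n xs

sum-upTo : ∀ n (g : ℕ → ℕ) → sum (map g (map suc (upTo n))) ≡ sumTo n g
sum-upTo zero    g = refl
sum-upTo (suc n) g = begin
  sum (map g (map suc (upTo (suc n))))
    ≡⟨ cong (λ l → sum (map g (map suc l))) (sym (upTo-∷ʳ n)) ⟩
  sum (map g (map suc (upTo n ++ n ∷ [])))
    ≡⟨ cong (λ l → sum (map g l)) (map-++ suc (upTo n) (n ∷ [])) ⟩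
  sum (map g (map suc (upTo n) ++ suc n ∷ []))
    ≡⟨ cong sum (map-++ g (map suc (upTo n)) (suc n ∷ [])) ⟩
  sum (map g (map suc (upTo n)) ++ g (suc n) ∷ [])
    ≡⟨ sum-++ (map g (map suc (upTo n))) (g (suc n) ∷ []) ⟩
  sum (map g (map suc (upTo n))) + (g (suc n) + 0)
    ≡⟨ cong₂ _+_ (sum-upTo n g) (+-identityʳ (g (suc n))) ⟩
  sumTo n g + g (suc n) ∎
  where open ≡-Reasoning

σ-sumTo : ∀ n → σ n ≡ sumTo n (divisorTerm n)
σ-sumTo n = trans (sum-filter-divides n (map suc (upTo n))) (sum-upTo n (divisorTerm n))

sumTo-cong : ∀ n {f g : ℕ → ℕ} → (∀ d → 1 ≤ d → d ≤ n → f d ≡ g d) → sumTo n f ≡ sumTo n g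
sumTo-cong zero    f≗g = refl
sumTo-cong (suc n) f≗g =
  cong₂ _+_ (sumTo-cong n (λ d 1≤d d≤n → f≗g d 1≤d (m≤n⇒m≤1+n d≤n))) (f≗g (suc n) (s≤s z≤n) ≤-refl)

sumTo-+ : ∀ n (f g : ℕ → ℕ) → sumTo n (λ d → f d + g d) ≡ sumTo n f + sumTo n g
sumTo-+ zero    f g = refl
sumTo-+ (suc n) f g rewrite sumTo-+ n f g = interchange (sumTo n f) (sumTo n g) (f (suc n)) (g (suc n))
  where
  interchange : ∀ a b c d → a + b + (c + d) ≡ a + c + (b + d)
  interchange = solve-∀

sumTo-* : ∀ n c (f : ℕ → ℕ) → sumTo n (λ d → c * f d) ≡ c * sumTo n f
sumTo-* zero    c f = sym (*-zeroʳ c)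
sumTo-* (suc n) c f rewrite sumTo-* n c f = sym (*-distribˡ-+ c (sumTo n f) (f (suc n)))

sumTo-vanishing : ∀ n (f : ℕ → ℕ) → (∀ d → 1 ≤ d → d ≤ n → f d ≡ 0) → sumTo n f ≡ 0
sumTo-vanishing zero    f f≡0 = refl
sumTo-vanishing (suc n) f f≡0
  rewrite sumTo-vanishing n f (λ d 1≤d d≤n → f≡0 d 1≤d (m≤n⇒m≤1+n d≤n))
        | f≡0 (suc n) (s≤s z≤n) ≤-refl = refl

sumTo-++ : ∀ m k (g : ℕ → ℕ) → sumTo (m + k) g ≡ sumTo m g + sumTo k (λ i → g (m + i))
sumTo-++ m zero    g rewrite +-identityʳ m = sym (+-identityʳ _)
sumTo-++ m (suc k) g rewrite +-suc m k | sumTo-++ m k g = +-assoc (sumTo m g) _ _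

sumTo-beyond : ∀ {m n} (g : ℕ → ℕ) → m ≤ n → (∀ d → m < d → g d ≡ 0) → sumTo n g ≡ sumTo m g
sumTo-beyond {m} {n} g m≤n g≡0 = begin
  sumTo n g                                   ≡⟨ cong (λ x → sumTo x g) (sym (m+[n∸m]≡n m≤n)) ⟩
  sumTo (m + (n ∸ m)) g                       ≡⟨ sumTo-++ m (n ∸ m) g ⟩
  sumTo m g + sumTo (n ∸ m) (λ i → g (m + i)) ≡⟨ cong (sumTo m g +_) (sumTo-vanishing (n ∸ m) _ tail≡0) ⟩
  sumTo m g + 0                               ≡⟨ +-identityʳ _ ⟩
  sumTo m g                                   ∎
  where
  open ≡-Reasoning
  tail≡0 : ∀ i → 1 ≤ i → i ≤ n ∸ m → g (m + i) ≡ 0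
  tail≡0 i 1≤i _ = g≡0 (m + i) (subst (_≤ m + i) (+-comm m 1) (+-monoʳ-≤ m 1≤i))

sumTo-multiples : ∀ p .{{_ : NonZero p}} n (g : ℕ → ℕ) → (∀ d → ¬ (p ∣ d) → g d ≡ 0) →
                  sumTo (p * n) g ≡ sumTo n (λ e → g (p * e))
sumTo-multiples p zero    g g≡0 rewrite *-zeroʳ p = refl
sumTo-multiples p@(suc q) (suc n) g g≡0 = begin
  sumTo (p * suc n) g                     ≡⟨ cong (λ x → sumTo x g) (trans (*-suc p n) (+-comm p (p * n))) ⟩
  sumTo (p * n + p) g                     ≡⟨ sumTo-++ (p * n) p g ⟩
  sumTo (p * n) g + sumTo p (λ i → g (p * n + i))
    ≡⟨ cong₂ _+_ (sumTo-multiples p n g g≡0) block ⟩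
  sumTo n (λ e → g (p * e)) + g (p * suc n) ∎
  where
  open ≡-Reasoning
  -- Of the block p*n+1 .. p*n+p only the last term is a multiple of p.
  nonMultiple : ∀ i → 1 ≤ i → i ≤ q → g (p * n + i) ≡ 0
  nonMultiple i 1≤i i≤q = g≡0 (p * n + i) λ p∣ →
    <⇒≱ (s≤s i≤q) (∣⇒≤ {{>-nonZero 1≤i}} (∣m+n∣m⇒∣n p∣ (m∣m*n n)))
  block : sumTo p (λ i → g (p * n + i)) ≡ g (p * suc n)
  block = begin
    sumTo q (λ i → g (p * n + i)) + g (p * n + p)
      ≡⟨ cong (_+ g (p * n + p)) (sumTo-vanishing q _ nonMultiple) ⟩
    g (p * n + p)
      ≡⟨ cong g (trans (+-comm (p * n) p) (sym (*-suc p n))) ⟩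
    g (p * suc n) ∎

-- σ(p^(a+1) m) = p σ(p^a m) + σ m for a prime p ∤ m: the divisors of p^(a+1) m
-- that are multiples of p are p times the divisors of p^a m, the others divide m.

onMultiples offMultiples : ℕ → (ℕ → ℕ) → ℕ → ℕ
onMultiples  p g d = if does (p ∣? d) then g d else 0
offMultiples p g d = if does (p ∣? d) then 0 else g d

on+off : ∀ p (g : ℕ → ℕ) d → g d ≡ onMultiples p g d + offMultiples p g d
on+off p g d with does (p ∣? d)
... | true  = sym (+-identityʳ (g d))
... | false = refl

σ-sumTo-beyond : ∀ {m n} → 1 ≤ m → m ≤ n → sumTo n (divisorTerm m) ≡ σ m
σ-sumTo-beyond {m} 1≤m m≤n = trans (sumTo-beyond (divisorTerm m) m≤n vanish) (sym (σ-sumTo m))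
  where
  vanish : ∀ d → m < d → divisorTerm m d ≡ 0
  vanish d m<d with d ∣? m
  ... | yes d∣m = ⊥-elim (<⇒≱ m<d (∣⇒≤ {{>-nonZero 1≤m}} d∣m))
  ... | no  _   = refl

divisorTerm-scaled : ∀ p .{{_ : NonZero p}} n e →
                     onMultiples p (divisorTerm (p * n)) (p * e) ≡ p * divisorTerm n e
divisorTerm-scaled p n e with p ∣? (p * e)
... | no  p∤pe = ⊥-elim (p∤pe (m∣m*n e))
... | yes _ with (p * e) ∣? (p * n) | e ∣? n
...   | yes _     | yes _   = refl
...   | no  _     | no  _   = sym (*-zeroʳ p)
...   | yes pe∣pn | no  e∤n = ⊥-elim (e∤n (*-cancelˡ-∣ p pe∣pn))
...   | no  pe∤pn | yes e∣n = ⊥-elim (pe∤pn (*-monoʳ-∣ p e∣n))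

σ-multiples : ∀ p .{{_ : NonZero p}} n → sumTo (p * n) (onMultiples p (divisorTerm (p * n))) ≡ p * σ n
σ-multiples p n = begin
  sumTo (p * n) (onMultiples p (divisorTerm (p * n)))     ≡⟨ sumTo-multiples p n _ offVanishes ⟩
  sumTo n (λ e → onMultiples p (divisorTerm (p * n)) (p * e)) ≡⟨ sumTo-cong n (λ e _ _ → divisorTerm-scaled p n e) ⟩
  sumTo n (λ e → p * divisorTerm n e)                    ≡⟨ sumTo-* n p (divisorTerm n) ⟩
  p * sumTo n (divisorTerm n)                            ≡⟨ cong (p *_) (sym (σ-sumTo n)) ⟩
  p * σ n                                                ∎
  where
  open ≡-Reasoning
  offVanishes : ∀ d → ¬ (p ∣ d) → onMultiples p (divisorTerm (p * n)) d ≡ 0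
  offVanishes d p∤d with p ∣? d
  ... | yes p∣d = ⊥-elim (p∤d p∣d)
  ... | no  _   = refl

prime≥2 : ∀ {p} → Prime p → 2 ≤ p
prime≥2 {p} (prime {{nt}} _) = nonTrivial⇒n>1 p {{nt}}

prime∤1 : ∀ {p} → Prime p → ¬ (p ∣ 1)
prime∤1 pp p∣1 = <⇒≱ (prime≥2 pp) (∣⇒≤ p∣1)

prime∤⇒coprime : ∀ {p d} → Prime p → ¬ (p ∣ d) → Coprime d p
prime∤⇒coprime pp p∤d {i} (i∣d , i∣p) with prime⇒irreducible pp i∣p
... | inj₁ i≡1 = i≡1
... | inj₂ refl = ⊥-elim (p∤d i∣d)

∣-cancel-prime-power : ∀ {p d} a x → Prime p → ¬ (p ∣ d) → d ∣ p ^ a * x → d ∣ x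
∣-cancel-prime-power zero    x pp p∤d d∣ = subst (_ ∣_) (+-identityʳ x) d∣
∣-cancel-prime-power {p} {d} (suc a) x pp p∤d d∣ = ∣-cancel-prime-power a x pp p∤d
  (coprime-divisor (prime∤⇒coprime pp p∤d) (subst (d ∣_) (*-assoc p (p ^ a) x) d∣))

divisorTerm-coprime : ∀ {p m} a d → Prime p → ¬ (p ∣ m) →
                      offMultiples p (divisorTerm (p ^ a * m)) d ≡ divisorTerm m d
divisorTerm-coprime {p} {m} a d pp p∤m with p ∣? d
... | yes p∣d with d ∣? m
...   | yes d∣m = ⊥-elim (p∤m (∣-trans p∣d d∣m))
...   | no  _   = refl
divisorTerm-coprime {p} {m} a d pp p∤m | no p∤d with d ∣? (p ^ a * m) | d ∣? m
...   | yes _   | yes _   = refl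
...   | no  _   | no  _   = refl
...   | yes d∣N | no  d∤m = ⊥-elim (d∤m (∣-cancel-prime-power a m pp p∤d d∣N))
...   | no  d∤N | yes d∣m = ⊥-elim (d∤N (∣n⇒∣m*n (p ^ a) d∣m))

∤⇒positive : ∀ {p m} → ¬ (p ∣ m) → 1 ≤ m
∤⇒positive {p} {zero}  p∤0 = ⊥-elim (p∤0 (p ∣0))
∤⇒positive {p} {suc m} _   = s≤s z≤n

σ-split : ∀ {p m} a → Prime p → ¬ (p ∣ m) → σ (p ^ suc a * m) ≡ p * σ (p ^ a * m) + σ m
σ-split {p} {m} a pp p∤m = begin
  σ N                                    ≡⟨ σ-sumTo N ⟩
  sumTo N (divisorTerm N)                ≡⟨ sumTo-cong N (λ d _ _ → on+off p (divisorTerm N) d) ⟩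
  sumTo N (λ d → onMultiples p (divisorTerm N) d + offMultiples p (divisorTerm N) d)
                                         ≡⟨ sumTo-+ N _ _ ⟩
  sumTo N (onMultiples p (divisorTerm N)) + sumTo N (offMultiples p (divisorTerm N))
                                         ≡⟨ cong₂ _+_ multiples coprimes ⟩
  p * σ n + σ m                          ∎
  where
  open ≡-Reasoning
  instance
    p≢0 : NonZero p
    p≢0 = >-nonZero (≤-trans (s≤s z≤n) (prime≥2 pp))
  n N : ℕ
  n = p ^ a * m
  N = p ^ suc a * m
  N≡pn : N ≡ p * n
  N≡pn = *-assoc p (p ^ a) m
  multiples : sumTo N (onMultiples p (divisorTerm N)) ≡ p * σ n
  multiples rewrite N≡pn = σ-multiples p n
  m≤N : m ≤ N
  m≤N = m≤n*m m (p ^ suc a) {{m^n≢0 p (suc a)}}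
  coprimes : sumTo N (offMultiples p (divisorTerm N)) ≡ σ m
  coprimes = begin
    sumTo N (offMultiples p (divisorTerm N)) ≡⟨ sumTo-cong N (λ d _ _ → divisorTerm-coprime (suc a) d pp p∤m) ⟩
    sumTo N (divisorTerm m)                  ≡⟨ σ-sumTo-beyond (∤⇒positive p∤m) m≤N ⟩
    σ m                                      ∎

σ-prime-power-step : ∀ {p} a → Prime p → σ (p ^ suc a) ≡ p * σ (p ^ a) + 1
σ-prime-power-step {p} a pp = begin
  σ (p ^ suc a)         ≡⟨ cong σ (sym (*-identityʳ (p ^ suc a))) ⟩
  σ (p ^ suc a * 1)     ≡⟨ σ-split a pp (prime∤1 pp) ⟩
  p * σ (p ^ a * 1) + 1 ≡⟨ cong (λ x → p * σ x + 1) (*-identityʳ (p ^ a)) ⟩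
  p * σ (p ^ a) + 1     ∎
  where open ≡-Reasoning

σ-multiplicative : ∀ {p m} a → Prime p → ¬ (p ∣ m) → σ (p ^ a * m) ≡ σ (p ^ a) * σ m
σ-multiplicative {p} {m} zero    pp p∤m = trans (cong σ (+-identityʳ m)) (sym (+-identityʳ (σ m)))
σ-multiplicative {p} {m} (suc a) pp p∤m = begin
  σ (p ^ suc a * m)               ≡⟨ σ-split a pp p∤m ⟩
  p * σ (p ^ a * m) + σ m         ≡⟨ cong (λ x → p * x + σ m) (σ-multiplicative a pp p∤m) ⟩
  p * (σ (p ^ a) * σ m) + σ m     ≡⟨ factor p (σ (p ^ a)) (σ m) ⟩
  (p * σ (p ^ a) + 1) * σ m       ≡⟨ cong (_* σ m) (sym (σ-prime-power-step a pp)) ⟩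
  σ (p ^ suc a) * σ m             ∎
  where
  open ≡-Reasoning
  factor : ∀ x y z → x * (y * z) + z ≡ (x * y + 1) * z
  factor = solve-∀

σ-geometric : ∀ {p} a → Prime p → p ^ suc a ≡ suc (σ (p ^ a) * (p ∸ 1))
σ-geometric {zero} a pp with prime≥2 pp
... | ()
σ-geometric {suc q} zero    pp = base q
  where
  base : ∀ q → suc q * 1 ≡ suc (1 * q)
  base = solve-∀
σ-geometric {suc q} (suc a) pp = begin
  p * p ^ suc a                       ≡⟨ cong (p *_) (σ-geometric a pp) ⟩
  p * suc (s * q)                     ≡⟨ step q s ⟩
  suc ((p * s + 1) * q)               ≡⟨ cong (λ x → suc (x * q)) (sym (σ-prime-power-step a pp)) ⟩
  suc (σ (p ^ suc a) * q)             ∎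
  where
  open ≡-Reasoning
  p s : ℕ
  p = suc q
  s = σ (p ^ a)
  step : ∀ q s → suc q * suc (s * q) ≡ suc ((suc q * s + 1) * q)
  step = solve-∀

∏-* : ∀ k (f g : Fin k → ℕ) → ∏ k (λ i → f i * g i) ≡ ∏ k f * ∏ k g
∏-* zero    f g = refl
∏-* (suc k) f g rewrite ∏-* k (λ i → f (fsuc i)) (λ i → g (fsuc i)) = interchange (f fzero) (g fzero) _ _
  where
  interchange : ∀ a b c d → a * b * (c * d) ≡ a * c * (b * d)
  interchange = solve-∀

∏-mono : ∀ k (f g : Fin k → ℕ) → (∀ i → f i ≤ g i) → ∏ k f ≤ ∏ k g
∏-mono zero    f g f≤g = ≤-refl
∏-mono (suc k) f g f≤g = *-mono-≤ (f≤g fzero) (∏-mono k (λ i → f (fsuc i)) (λ i → g (fsuc i)) (λ i → f≤g (fsuc i)))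

∏-lower-bound : ∀ k b (f : Fin k → ℕ) → (∀ i → b ≤ f i) → b ^ k ≤ ∏ k f
∏-lower-bound zero    b f b≤f = ≤-refl
∏-lower-bound (suc k) b f b≤f = *-mono-≤ (b≤f fzero) (∏-lower-bound k b (λ i → f (fsuc i)) (λ i → b≤f (fsuc i)))

∏-positive : ∀ k (f : Fin k → ℕ) → (∀ i → 1 ≤ f i) → 1 ≤ ∏ k f
∏-positive k f 1≤f = subst (_≤ ∏ k f) (^-zeroˡ k) (∏-lower-bound k 1 f 1≤f)

prime∤∏ : ∀ {q} k (f : Fin k → ℕ) → Prime q → (∀ i → ¬ (q ∣ f i)) → ¬ (q ∣ ∏ k f)
prime∤∏ zero    f pq q∤f q∣1 = prime∤1 pq q∣1
prime∤∏ (suc k) f pq q∤f q∣∏ with euclidsLemma (f fzero) (∏ k (λ i → f (fsuc i))) pq q∣∏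
... | inj₁ q∣head = q∤f fzero q∣head
... | inj₂ q∣tail = prime∤∏ k (λ i → f (fsuc i)) pq (λ i → q∤f (fsuc i)) q∣tail

prime∣power⇒≡ : ∀ {q r} a → Prime q → Prime r → q ∣ r ^ a → q ≡ r
prime∣power⇒≡ zero    pq pr q∣1 = ⊥-elim (prime∤1 pq q∣1)
prime∣power⇒≡ {q} {r} (suc a) pq pr q∣ with euclidsLemma r (r ^ a) pq q∣
... | inj₂ q∣rᵃ = prime∣power⇒≡ a pq pr q∣rᵃ
... | inj₁ q∣r with prime⇒irreducible pr q∣r
...   | inj₂ q≡r = q≡r
...   | inj₁ refl = ⊥-elim (<⇒≱ (prime≥2 pq) ≤-refl)

σ-∏ : ∀ k (p e : Fin k → ℕ) → (∀ i → Prime (p i)) → Injective _≡_ _≡_ p →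
      σ (∏ k (λ i → p i ^ e i)) ≡ ∏ k (λ i → σ (p i ^ e i))
σ-∏ zero    p e primes distinct = refl
σ-∏ (suc k) p e primes distinct = begin
  σ (p fzero ^ e fzero * ∏ k (λ i → p (fsuc i) ^ e (fsuc i)))
    ≡⟨ σ-multiplicative (e fzero) (primes fzero) head∤tail ⟩
  σ (p fzero ^ e fzero) * σ (∏ k (λ i → p (fsuc i) ^ e (fsuc i)))
    ≡⟨ cong (σ (p fzero ^ e fzero) *_)
            (σ-∏ k (λ i → p (fsuc i)) (λ i → e (fsuc i)) (λ i → primes (fsuc i)) (λ eq → fsuc-injective (distinct eq))) ⟩
  ∏ (suc k) (λ i → σ (p i ^ e i)) ∎
  where
  open ≡-Reasoning
  head∤tail : ¬ (p fzero ∣ ∏ k (λ i → p (fsuc i) ^ e (fsuc i)))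
  head∤tail = prime∤∏ k _ (primes fzero)
    (λ i p₀∣ → fzero≢fsuc (distinct (prime∣power⇒≡ (e (fsuc i)) (primes fzero) (primes (fsuc i)) p₀∣)))

-- For a factorisation n = ∏ pᵢ^eᵢ write R = ∏ pᵢ for its radical and
-- Φ = ∏ (pᵢ - 1) = φ(R).  Then σ(n) Φ = ∏ (pᵢ^(eᵢ+1) - 1) and n R = ∏ pᵢ^(eᵢ+1).

Φ : (k : ℕ) → (Fin k → ℕ) → ℕ
Φ k p = ∏ k (λ i → p i ∸ 1)

σ-times-Φ : ∀ k (p e : Fin k → ℕ) → (∀ i → Prime (p i)) → Injective _≡_ _≡_ p →
            σ (∏ k (λ i → p i ^ e i)) * Φ k p ≡ ∏ k (λ i → σ (p i ^ e i) * (p i ∸ 1))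
σ-times-Φ k p e primes distinct =
  trans (cong (_* Φ k p) (σ-∏ k p e primes distinct)) (sym (∏-* k (λ i → σ (p i ^ e i)) (λ i → p i ∸ 1)))

power-times-radical : ∀ k (p e : Fin k → ℕ) → ∏ k (λ i → p i ^ e i) * ∏ k p ≡ ∏ k (λ i → p i ^ suc (e i))
power-times-radical k p e = trans (*-comm _ (∏ k p)) (sym (∏-* k p (λ i → p i ^ e i)))

∏-pred-≤ : ∀ k (c X : Fin k → ℕ) → (∀ i → X i ≡ suc (c i)) → ∏ k c ≤ ∏ k X
∏-pred-≤ k c X X≡ = ∏-mono k c X (λ i → subst (c i ≤_) (sym (X≡ i)) (n≤1+n (c i)))

∏-pred-< : ∀ k (c X : Fin (suc k) → ℕ) → (∀ i → X i ≡ suc (c i)) → ∏ (suc k) c < ∏ (suc k) X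
∏-pred-< k c X X≡ = begin-strict
  c fzero * Q         ≤⟨ *-monoʳ-≤ (c fzero) (∏-pred-≤ k _ _ (λ i → X≡ (fsuc i))) ⟩
  c fzero * P         <⟨ m<n+m (c fzero * P) P>0 ⟩
  P + c fzero * P     ≡⟨ cong (_* P) (sym (X≡ fzero)) ⟩
  X fzero * P         ∎
  where
  open ≤-Reasoning
  P Q : ℕ
  P = ∏ k (λ i → X (fsuc i))
  Q = ∏ k (λ i → c (fsuc i))
  P>0 : 0 < P
  P>0 = ∏-positive k _ (λ i → subst (1 ≤_) (sym (X≡ (fsuc i))) (s≤s z≤n))

-- Union bound: if every Xᵢ ≥ Y then ∏ X - ∏ (X - 1) ≤ (m / Y) ∏ X.
∏-union-bound : ∀ m (c X : Fin m → ℕ) Y → (∀ i → X i ≡ suc (c i)) → (∀ i → Y ≤ X i) →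
                Y * ∏ m X ≤ Y * ∏ m c + m * ∏ m X
∏-union-bound zero    c X Y X≡ Y≤X = m≤m+n (Y * 1) 0
∏-union-bound (suc m) c X Y X≡ Y≤X = begin
  Y * (X fzero * P)                      ≡⟨ cong (λ x → Y * (x * P)) (X≡ fzero) ⟩
  Y * (suc c₀ * P)                       ≡⟨ e₁ Y c₀ P ⟩
  suc c₀ * (Y * P)                       ≤⟨ *-monoʳ-≤ (suc c₀) tail-bound ⟩
  suc c₀ * (Y * Q + m * P)               ≡⟨ e₂ c₀ Y Q m P ⟩
  Y * (c₀ * Q) + (Y * Q + m * (suc c₀ * P)) ≤⟨ +-monoʳ-≤ (Y * (c₀ * Q)) (+-monoˡ-≤ _ YQ≤X₀P) ⟩
  Y * (c₀ * Q) + (suc c₀ * P + m * (suc c₀ * P)) ≡⟨ cong (λ x → Y * (c₀ * Q) + (x * P + m * (x * P))) (sym (X≡ fzero)) ⟩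
  Y * (c₀ * Q) + suc m * (X fzero * P)   ∎
  where
  open ≤-Reasoning
  c₀ P Q : ℕ
  c₀ = c fzero
  P  = ∏ m (λ i → X (fsuc i))
  Q  = ∏ m (λ i → c (fsuc i))
  tail-bound : Y * P ≤ Y * Q + m * P
  tail-bound = ∏-union-bound m _ _ Y (λ i → X≡ (fsuc i)) (λ i → Y≤X (fsuc i))
  YQ≤X₀P : Y * Q ≤ suc c₀ * P
  YQ≤X₀P = *-mono-≤ (subst (Y ≤_) (X≡ fzero) (Y≤X fzero)) (∏-pred-≤ m _ _ (λ i → X≡ (fsuc i)))
  e₁ : ∀ Y c P → Y * (suc c * P) ≡ suc c * (Y * P)
  e₁ = solve-∀
  e₂ : ∀ c Y Q m P → suc c * (Y * Q + m * P) ≡ Y * (c * Q) + (Y * Q + m * (suc c * P))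
  e₂ = solve-∀

-- The arithmetic core, for a product whose head factor A = a + 1 is split off:
-- with A ≥ 2R and Y ≥ 2mR, the union bound YP ≤ YQ + mP on the remaining factors
-- yields (a Q) / (A P) ≥ 1 - 1/R.  The margin lemma is the linear inequality behind it.

margin : ∀ {R a m Y} → 2 * R ≤ suc a → 2 * (m * R) ≤ Y → R * Y + R * a * m ≤ suc a * Y
margin {R} {a} {m} {Y} 2R≤A 2mR≤Y = *-cancelˡ-≤ 2 (begin
  2 * (R * Y + R * a * m)         ≡⟨ e₁ R Y a m ⟩
  2 * R * Y + a * (2 * (m * R))   ≤⟨ +-mono-≤ (*-monoˡ-≤ Y 2R≤A) (*-monoʳ-≤ a 2mR≤Y) ⟩
  suc a * Y + a * Y               ≤⟨ +-monoʳ-≤ (suc a * Y) (*-monoˡ-≤ Y (n≤1+n a)) ⟩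
  suc a * Y + suc a * Y           ≡⟨ e₂ (suc a * Y) ⟩
  2 * (suc a * Y)                 ∎)
  where
  open ≤-Reasoning
  e₁ : ∀ R Y a m → 2 * (R * Y + R * a * m) ≡ 2 * R * Y + a * (2 * (m * R))
  e₁ = solve-∀
  e₂ : ∀ t → t + t ≡ 2 * t
  e₂ = solve-∀

tail-estimate : ∀ {R a m Y P Q} → 0 < Y → Y * P ≤ Y * Q + m * P → 2 * R ≤ suc a → 2 * (m * R) ≤ Y →
                suc a * P * R ≤ R * (a * Q) + suc a * P
tail-estimate {R} {a} {m} {Y} {P} {Q} Y>0 union 2R≤A 2mR≤Y =
  *-cancelˡ-≤ Y {{>-nonZero Y>0}} (+-cancelʳ-≤ (R * a * (m * P)) _ _ (begin
    Y * (suc a * P * R) + R * a * (m * P)     ≡⟨ e₁ Y a P R m ⟩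
    P * (a * (R * Y) + (R * Y + R * a * m))   ≤⟨ *-monoʳ-≤ P (+-monoʳ-≤ (a * (R * Y)) (margin {R} {a} {m} 2R≤A 2mR≤Y)) ⟩
    P * (a * (R * Y) + suc a * Y)             ≡⟨ e₂ P a R Y ⟩
    R * a * (Y * P) + suc a * (Y * P)         ≤⟨ +-monoˡ-≤ (suc a * (Y * P)) (*-monoʳ-≤ (R * a) union) ⟩
    R * a * (Y * Q + m * P) + suc a * (Y * P) ≡⟨ e₃ R a Y Q m P ⟩
    Y * (R * (a * Q) + suc a * P) + R * a * (m * P) ∎))
  where
  open ≤-Reasoning
  e₁ : ∀ Y a P R m → Y * (suc a * P * R) + R * a * (m * P) ≡ P * (a * (R * Y) + (R * Y + R * a * m))
  e₁ = solve-∀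
  e₂ : ∀ P a R Y → P * (a * (R * Y) + suc a * Y) ≡ R * a * (Y * P) + suc a * (Y * P)
  e₂ = solve-∀
  e₃ : ∀ R a Y Q m P → R * a * (Y * Q + m * P) + suc a * (Y * P) ≡ Y * (R * (a * Q) + suc a * P) + R * a * (m * P)
  e₃ = solve-∀

∏-ratio-bound : ∀ m (c X : Fin (suc m) → ℕ) R Y → (∀ i → X i ≡ suc (c i)) →
                2 * R ≤ X fzero → 0 < Y → 2 * (m * R) ≤ Y → (∀ i → Y ≤ X (fsuc i)) →
                ∏ (suc m) X * R ≤ R * ∏ (suc m) c + ∏ (suc m) X
∏-ratio-bound m c X R Y X≡ 2R≤X₀ Y>0 2mR≤Y Y≤X =
  subst (λ x → x * P * R ≤ R * (c fzero * Q) + x * P) (sym (X≡ fzero))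
    (tail-estimate {R} {c fzero} {m} {Y} {P} {Q} Y>0 (∏-union-bound m _ _ Y (λ i → X≡ (fsuc i)) Y≤X) (subst (2 * R ≤_) (X≡ fzero) 2R≤X₀) 2mR≤Y)
  where
  P Q : ℕ
  P = ∏ m (λ i → X (fsuc i))
  Q = ∏ m (λ i → c (fsuc i))

-- Abundance of n = ∏ pᵢ^eᵢ forces 2 φ(R) < R, since σ(n) φ(R) = ∏ (Xᵢ - 1) < ∏ Xᵢ = n R.
abundant⇒2Φ<R : ∀ m (p e : Fin (suc m) → ℕ) → (∀ i → Prime (p i)) → Injective _≡_ _≡_ p →
                2 * ∏ (suc m) (λ i → p i ^ e i) ≤ σ (∏ (suc m) (λ i → p i ^ e i)) →
                2 * Φ (suc m) p < ∏ (suc m) p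
abundant⇒2Φ<R m p e primes distinct abundant = *-cancelˡ-< n _ _ (begin-strict
  n * (2 * Φ (suc m) p)                       ≡⟨ swap n (Φ (suc m) p) ⟩
  2 * n * Φ (suc m) p                         ≤⟨ *-monoˡ-≤ (Φ (suc m) p) abundant ⟩
  σ n * Φ (suc m) p                           ≡⟨ σ-times-Φ (suc m) p e primes distinct ⟩
  ∏ (suc m) (λ i → σ (p i ^ e i) * (p i ∸ 1)) <⟨ ∏-pred-< m _ _ (λ i → σ-geometric (e i) (primes i)) ⟩
  ∏ (suc m) (λ i → p i ^ suc (e i))           ≡⟨ sym (power-times-radical (suc m) p e) ⟩
  n * ∏ (suc m) p                             ∎)
  where
  open ≤-Reasoning
  n : ℕ
  n = ∏ (suc m) (λ i → p i ^ e i)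
  swap : ∀ n f → n * (2 * f) ≡ 2 * n * f
  swap = solve-∀

σ-ratio-bound : ∀ m (p e : Fin (suc m) → ℕ) Y → (∀ i → Prime (p i)) → Injective _≡_ _≡_ p →
                2 * ∏ (suc m) p ≤ p fzero ^ suc (e fzero) → 0 < Y → 2 * (m * ∏ (suc m) p) ≤ Y →
                (∀ i → Y ≤ p (fsuc i) ^ suc (e (fsuc i))) →
                let n = ∏ (suc m) (λ i → p i ^ e i); R = ∏ (suc m) p in
                n * R * R ≤ R * (σ n * Φ (suc m) p) + n * R
σ-ratio-bound m p e Y primes distinct 2R≤X₀ Y>0 2mR≤Y Y≤X = begin
  n * R * R                 ≡⟨ cong (_* R) nR≡∏X ⟩
  ∏ (suc m) X * R           ≤⟨ ∏-ratio-bound m c X R Y (λ i → σ-geometric (e i) (primes i)) 2R≤X₀ Y>0 2mR≤Y Y≤X ⟩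
  R * ∏ (suc m) c + ∏ (suc m) X ≡⟨ cong₂ (λ u v → R * u + v) (sym (σ-times-Φ (suc m) p e primes distinct)) (sym nR≡∏X) ⟩
  R * (σ n * Φ (suc m) p) + n * R ∎
  where
  open ≤-Reasoning
  n R : ℕ
  n = ∏ (suc m) (λ i → p i ^ e i)
  R = ∏ (suc m) p
  c X : Fin (suc m) → ℕ
  c i = σ (p i ^ e i) * (p i ∸ 1)
  X i = p i ^ suc (e i)
  nR≡∏X : n * R ≡ ∏ (suc m) X
  nR≡∏X = power-times-radical (suc m) p e

non-deficiency-criterion : ∀ {n s Φ R} → 0 < Φ → 2 * Φ < R → n * R * R ≤ R * (s * Φ) + n * R → 2 * n ≤ s
non-deficiency-criterion {n} {s} {Φ} {R} Φ>0 2Φ<R bound =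
  *-cancelʳ-≤ (2 * n) s Φ {{>-nonZero Φ>0}}
    (*-cancelˡ-≤ R {{>-nonZero (≤-trans (s≤s z≤n) 2Φ<R)}} (+-cancelʳ-≤ (n * R) _ _ (begin
      R * (2 * n * Φ) + n * R ≡⟨ e R n Φ ⟩
      n * R * suc (2 * Φ)     ≤⟨ *-monoʳ-≤ (n * R) 2Φ<R ⟩
      n * R * R               ≤⟨ bound ⟩
      R * (s * Φ) + n * R     ∎)))
  where
  open ≤-Reasoning
  e : ∀ R n Φ → R * (2 * n * Φ) + n * R ≡ n * R * suc (2 * Φ)
  e = solve-∀

^-reflectˡ-≤ : ∀ n .{{_ : NonZero n}} {x y} → x ^ n ≤ y ^ n → x ≤ y
^-reflectˡ-≤ n xⁿ≤yⁿ = ≮⇒≥ (λ y<x → <⇒≱ (^-monoˡ-< n y<x) xⁿ≤yⁿ)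

square≤cube : ∀ x a → 1 ≤ x → 2 ≤ a → (x ^ suc a) ^ 2 ≤ (x ^ a) ^ 3
square≤cube x (suc zero) 1≤x (s≤s ())
square≤cube x a@(suc (suc b)) 1≤x _ = begin
  (x ^ suc a) ^ 2 ≡⟨ ^-*-assoc x (suc a) 2 ⟩
  x ^ (suc a * 2) ≤⟨ ^-monoʳ-≤ x {{>-nonZero 1≤x}} (subst (suc a * 2 ≤_) (exponents b) (m≤m+n _ b)) ⟩
  x ^ (a * 3)     ≡⟨ sym (^-*-assoc x a 3) ⟩
  (x ^ a) ^ 3     ∎
  where
  open ≤-Reasoning
  exponents : ∀ b → (3 + b) * 2 + b ≡ (2 + b) * 3
  exponents = solve-∀

head-bound : ∀ {x a R} → 1 ≤ x → 2 ≤ a → 64 * R ^ 3 ≤ (x ^ suc a) ^ 2 → 2 * R ≤ x ^ a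
head-bound {x} {a} {R} 1≤x 2≤a large = ^-reflectˡ-≤ 3 (begin
  (2 * R) ^ 3     ≡⟨ cube R ⟩
  8 * R ^ 3       ≤⟨ *-monoˡ-≤ (R ^ 3) (m≤m+n 8 56) ⟩
  64 * R ^ 3      ≤⟨ large ⟩
  (x ^ suc a) ^ 2 ≤⟨ square≤cube x a 1≤x 2≤a ⟩
  (x ^ a) ^ 3     ∎)
  where
  open ≤-Reasoning
  cube : ∀ R → (2 * R) * ((2 * R) * ((2 * R) * 1)) ≡ 8 * (R * (R * (R * 1)))
  cube = solve-∀

tail-bound : ∀ {m R Y} → m * m ≤ R → 64 * R ^ 3 ≤ Y ^ 2 → 2 * (m * R) ≤ Y
tail-bound {m} {R} {Y} m²≤R large = ^-reflectˡ-≤ 2 (begin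
  (2 * (m * R)) ^ 2     ≡⟨ square m R ⟩
  4 * (m * m) * (R * R) ≤⟨ *-monoˡ-≤ (R * R) (*-monoʳ-≤ 4 m²≤R) ⟩
  4 * R * (R * R)       ≡⟨ cube R ⟩
  4 * R ^ 3             ≤⟨ *-monoˡ-≤ (R ^ 3) (m≤m+n 4 60) ⟩
  64 * R ^ 3            ≤⟨ large ⟩
  Y ^ 2                 ∎)
  where
  open ≤-Reasoning
  square : ∀ m R → (2 * (m * R)) * ((2 * (m * R)) * 1) ≡ 4 * (m * m) * (R * R)
  square = solve-∀
  cube : ∀ R → 4 * R * (R * R) ≡ 4 * (R * (R * (R * 1)))
  cube = solve-∀

n<2^n : ∀ n → n < 2 ^ n
n<2^n zero    = s≤s z≤n
n<2^n (suc n) = begin-strict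
  suc n           <⟨ +-monoʳ-< 1 (n<2^n n) ⟩
  1 + 2 ^ n       ≤⟨ +-monoˡ-≤ (2 ^ n) (m^n>0 2 n) ⟩
  2 ^ n + 2 ^ n   ≡⟨ cong (2 ^ n +_) (sym (+-identityʳ (2 ^ n))) ⟩
  2 ^ suc n       ∎
  where open ≤-Reasoning

-- m² ≤ 2^(m+1); with m+1 primes, 2^(m+1) ≤ R.
square≤2^suc : ∀ m → m * m ≤ 2 ^ suc m
square≤2^suc zero    = z≤n
square≤2^suc (suc m) = begin
  suc m * suc m         ≡⟨ expand m ⟩
  m * m + suc (2 * m)   ≤⟨ +-mono-≤ (square≤2^suc m) (≤-trans (n≤1+n _) (≤-trans (≤-reflexive (double m)) (*-monoʳ-≤ 2 (n<2^n m)))) ⟩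
  2 ^ suc m + 2 * 2 ^ m ≡⟨⟩
  2 ^ suc m + 2 ^ suc m ≡⟨ cong (2 ^ suc m +_) (sym (+-identityʳ (2 ^ suc m))) ⟩
  2 ^ suc (suc m)       ∎
  where
  open ≤-Reasoning
  expand : ∀ m → suc m * suc m ≡ m * m + suc (2 * m)
  expand = solve-∀
  double : ∀ m → suc (suc (2 * m)) ≡ 2 * suc m
  double = solve-∀

argmin : ∀ k (f : Fin (suc k) → ℕ) → ∃ λ j → ∀ i → f j ≤ f i
argmin zero    f = fzero , λ { fzero → ≤-refl }
argmin (suc k) f with argmin k (λ i → f (fsuc i))
... | j , minimal with f fzero ≤? f (fsuc j)
...   | yes f₀≤ = fzero , λ { fzero → ≤-refl ; (fsuc i) → ≤-trans f₀≤ (minimal i) }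
...   | no  f₀≰ = fsuc j , λ { fzero → <⇒≤ (≰⇒> f₀≰) ; (fsuc i) → minimal i }

cofactor-proper : ∀ {p n′} → 2 ≤ p → 0 < n′ → ProperDivisor n′ (p * n′)
cofactor-proper {p} {n′} 2≤p n′>0 =
  divides p refl , n′>0 , subst (n′ <_) (*-comm n′ p) (m<m*n n′ p {{>-nonZero n′>0}} 2≤p)

-- The heart of the theorem: if every Xⱼ = pⱼ^(aⱼ+1) had Xⱼ² ≥ 64 R³, then the
-- proper divisor N / p₀ would already be non-deficient.
not-all-large : ∀ m (p a : Fin (suc m) → ℕ) → (∀ i → Prime (p i)) → Injective _≡_ _≡_ p →
                (∀ i → a i ≥ 2) → PrimitiveNonDeficient (∏ (suc m) (λ i → p i ^ a i)) →
                ¬ (∀ j → 64 * (∏ (suc m) p) ^ 3 ≤ (p j ^ suc (a j)) ^ 2)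
not-all-large m p a primes distinct a≥2 (_ , abundant , proper⇒deficient) large =
  <⇒≱ (proj₂ (proper⇒deficient N′ N′-proper)) N′-non-deficient
  where
  R p₀ b : ℕ
  R  = ∏ (suc m) p
  p₀ = p fzero
  b  = pred (a fzero)
  1+b≡a₀ : suc b ≡ a fzero
  1+b≡a₀ = suc-pred (a fzero) {{>-nonZero (≤-trans (s≤s z≤n) (a≥2 fzero))}}
  p₀≥2 : 2 ≤ p₀
  p₀≥2 = prime≥2 (primes fzero)
  -- the exponents of N / p₀
  e : Fin (suc m) → ℕ
  e fzero    = b
  e (fsuc i) = a (fsuc i)
  N′ : ℕ
  N′ = ∏ (suc m) (λ i → p i ^ e i)
  N≡p₀N′ : ∏ (suc m) (λ i → p i ^ a i) ≡ p₀ * N′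
  N≡p₀N′ = trans (cong (λ x → p₀ ^ x * ∏ m (λ i → p (fsuc i) ^ a (fsuc i))) (sym 1+b≡a₀))
                 (*-assoc p₀ (p₀ ^ b) _)
  N′-proper : ProperDivisor N′ (∏ (suc m) (λ i → p i ^ a i))
  N′-proper = subst (ProperDivisor N′) (sym N≡p₀N′)
    (cofactor-proper p₀≥2 (∏-positive (suc m) _ (λ i → m^n>0 (p i) {{>-nonZero (≤-trans (s≤s z≤n) (prime≥2 (primes i)))}} (e i))))
  j : Fin (suc m)
  j = proj₁ (argmin m (λ i → p i ^ suc (a i)))
  Y : ℕ
  Y = p j ^ suc (a j)
  Y≤X : ∀ i → Y ≤ p i ^ suc (a i)
  Y≤X = proj₂ (argmin m (λ i → p i ^ suc (a i)))
  Y>0 : 0 < Y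
  Y>0 = subst (0 <_) (sym (σ-geometric (a j) (primes j))) (s≤s z≤n)
  m²≤R : m * m ≤ R
  m²≤R = ≤-trans (square≤2^suc m) (∏-lower-bound (suc m) 2 p (λ i → prime≥2 (primes i)))
  2R≤X′₀ : 2 * R ≤ p₀ ^ suc b
  2R≤X′₀ = subst (λ x → 2 * R ≤ p₀ ^ x) (sym 1+b≡a₀) (head-bound {p₀} {a fzero} {R} (≤-trans (s≤s z≤n) p₀≥2) (a≥2 fzero) (large fzero))
  Φ>0 : 0 < Φ (suc m) p
  Φ>0 = ∏-positive (suc m) _ (λ i → ∸-monoˡ-≤ 1 (prime≥2 (primes i)))
  N′-non-deficient : 2 * N′ ≤ σ N′
  N′-non-deficient = non-deficiency-criterion {N′} {σ N′} {Φ (suc m) p} {R} Φ>0 (abundant⇒2Φ<R m p a primes distinct abundant)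
    (σ-ratio-bound m p e Y primes distinct 2R≤X′₀ Y>0 (tail-bound {m} {R} {Y} m²≤R (large j)) (λ i → Y≤X (fsuc i)))

mainTheorem9 : (N k : ℕ) (p a : Fin k → ℕ) →
    PrimitiveNonDeficient N →
    (∀ i → Prime (p i)) →
    Injective _≡_ _≡_ p →
    N ≡ ∏ k (λ i → p i ^ a i) →
    (∀ i → a i ≥ 2) →
    ∃ λ (j : Fin k) → (p j ^ suc (a j)) ^ 2 < 64 * (∏ k p) ^ 3
-- With no primes N = 1, and σ 1 = 1 < 2.
mainTheorem9 N zero    p a (_ , abundant , _) primes distinct refl a≥2 = ⊥-elim (<⇒≱ (s≤s (s≤s z≤n)) abundant)
mainTheorem9 N (suc m) p a pnd primes distinct refl a≥2
  with any? (λ j → (p j ^ suc (a j)) ^ 2 <? 64 * (∏ (suc m) p) ^ 3)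
... | yes small = small
... | no  none  = ⊥-elim (not-all-large m p a primes distinct a≥2 pnd (λ j → ≮⇒≥ (λ small → none (j , small))))
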